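{- For any Heyting algebra $H$ and any $x,h,a\in H$, one has $x\to h\in\mathcal D_a(H)$ if and only if $x\le(h\to a)\to h$.
   Context: For $a$ in a Heyting algebra $H$, $\mathcal D_a(H)=\{d\in H: a\le d\text{ and }(d\to a)=a\}$ (the elements dense over $a$). -}

module Defs where

open import Level using (_⊔_)
open import Data.Product using (_×_)
open import Relation.Binary.Lattice.Bundles using (HeytingAlgebra)

Dense : ∀ {c ℓ₁ ℓ₂} (H : HeytingAlgebra c ℓ₁ ℓ₂) →
        HeytingAlgebra.Carrier H → HeytingAlgebra.Carrier H → Set (ℓ₁ ⊔ ℓ₂)
Dense H a d = (a ≤ d) × ((d ⇨ a) ≈ a)
  where open HeytingAlgebra H

-- Both sides reduce to x ∧ (h ⇨ a) ≤ h.  An element d lies in 𝒟_a exactly when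
-- d ⇨ a ≤ d, and for d = x ⇨ h this is again x ∧ ((x ⇨ h) ⇨ a) ≤ h.  Since
-- h ≤ x ⇨ h we have (x ⇨ h) ⇨ a ≤ h ⇨ a, giving one direction; conversely
-- x ∧ (h ⇨ a) ∧ (x ⇨ h) ≤ a, so x ∧ (h ⇨ a) ≤ (x ⇨ h) ⇨ a ≤ x ⇨ h, whence ≤ h.
module Submission where

open import Defs
open import Data.Product using (_,_)
open import Function.Bundles using (_⇔_; mk⇔)
open import Function.Properties.Equivalence using () renaming (trans to ⇔-trans)
open import Relation.Binary.Lattice.Bundles using (HeytingAlgebra)
import Relation.Binary.Lattice.Properties.HeytingAlgebra as HeytingAlgebraProperties
import Relation.Binary.Lattice.Properties.MeetSemilattice as MeetSemilatticeProperties

module _ {c ℓ₁ ℓ₂} (H : HeytingAlgebra c ℓ₁ ℓ₂) where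

  open HeytingAlgebra H
  open HeytingAlgebraProperties H
  open MeetSemilatticeProperties meetSemilattice using (∧-monotonic)

  dense⇔⇨≤ : ∀ {a d} → Dense H a d ⇔ (d ⇨ a) ≤ d
  dense⇔⇨≤ {a} {d} = mk⇔ to from
    where
    to : Dense H a d → (d ⇨ a) ≤ d
    to (a≤d , d⇨a≈a) = trans (reflexive d⇨a≈a) a≤d

    from : (d ⇨ a) ≤ d → Dense H a d
    from d⇨a≤d = trans y≤x⇨y d⇨a≤d , antisym d⇨a≤a y≤x⇨y
      where
      d⇨a≤a : (d ⇨ a) ≤ a
      d⇨a≤a = trans (∧-greatest refl d⇨a≤d) ⇨-eval

  [x⇨h]⇨a≤x⇨h⇔x∧[h⇨a]≤h : ∀ {x h a} → ((x ⇨ h) ⇨ a) ≤ (x ⇨ h) ⇔ (x ∧ (h ⇨ a)) ≤ h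
  [x⇨h]⇨a≤x⇨h⇔x∧[h⇨a]≤h {x} {h} {a} = mk⇔ to from
    where
    to : ((x ⇨ h) ⇨ a) ≤ (x ⇨ h) → (x ∧ (h ⇨ a)) ≤ h
    to [x⇨h]⇨a≤x⇨h = trans (∧-greatest (x∧y≤x _ _) (trans x∧[h⇨a]≤[x⇨h]⇨a [x⇨h]⇨a≤x⇨h)) (⇨-applyʳ refl)
      where
      x∧[h⇨a]∧[x⇨h]≤h : ((x ∧ (h ⇨ a)) ∧ (x ⇨ h)) ≤ h
      x∧[h⇨a]∧[x⇨h]≤h = trans (∧-greatest (x∧y≤y _ _) (trans (x∧y≤x _ _) (x∧y≤x _ _))) ⇨-eval

      x∧[h⇨a]≤[x⇨h]⇨a : (x ∧ (h ⇨ a)) ≤ ((x ⇨ h) ⇨ a)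
      x∧[h⇨a]≤[x⇨h]⇨a = transpose-⇨ (trans (∧-greatest (trans (x∧y≤x _ _) (x∧y≤y _ _)) x∧[h⇨a]∧[x⇨h]≤h) ⇨-eval)

    from : (x ∧ (h ⇨ a)) ≤ h → ((x ⇨ h) ⇨ a) ≤ (x ⇨ h)
    from x∧[h⇨a]≤h = swap-transpose-⇨ (trans (∧-monotonic refl (⇨ˡ-contravariant y≤x⇨y)) x∧[h⇨a]≤h)

  ∧≤⇔≤⇨ : ∀ {x y z} → (x ∧ y) ≤ z ⇔ x ≤ (y ⇨ z)
  ∧≤⇔≤⇨ = mk⇔ transpose-⇨ transpose-∧

corollary2p5 : ∀ {c ℓ₁ ℓ₂} (H : HeytingAlgebra c ℓ₁ ℓ₂) (x h a : HeytingAlgebra.Carrier H) →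
    Dense H a (HeytingAlgebra._⇨_ H x h) ⇔ HeytingAlgebra._≤_ H x (HeytingAlgebra._⇨_ H (HeytingAlgebra._⇨_ H h a) h)
corollary2p5 H x h a =
  ⇔-trans (dense⇔⇨≤ H) (⇔-trans ([x⇨h]⇨a≤x⇨h⇔x∧[h⇨a]≤h H) (∧≤⇔≤⇨ H))
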